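{- A sequence $(a_n(q))_{n\ge1}$ in $\mathbb{Z}[q]$ is a $q$-Gauss sequence if and only if there exists a sequence $(g_n(q))_{n\ge1}$ in $\mathbb{Z}[q]$ such that $a_n(q)=\sum_{d\mid n}\left[\tfrac{n}{d}\right]_{q^d}\,g_{n/d}(q^d)$ for all $n\ge1$.
   Context: $[n]_q=1+q+\cdots+q^{n-1}$ and $[k]_{q^d}$ is $[k]_q$ evaluated at $q^d$; $\mu$ is the Möbius function. $(a_n(q))$ is a $q$-Gauss sequence if $\sum_{d\mid n}\mu(d)a_{n/d}(q^d)\equiv0\pmod{[n]_q}$ in $\mathbb{Z}[q]$ for all $n\ge1$. -}

module Defs where

open import Data.Bool using (Bool; true; false; if_then_else_; _∧_)
open import Data.Nat using (ℕ; zero; suc; _≤?_; _≤_)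
import Data.Nat as N
open import Data.Nat.DivMod using (_/_)
open import Data.Nat.Divisibility using (_∣?_)
open import Data.Nat.Primality using (prime?)
open import Data.Integer using (ℤ; +_; -_; _+_; _*_)
open import Data.List using (List; []; _∷_; replicate; _++_; upTo; filter; length; foldr)
open import Data.Bool.ListAction using (any)
open import Data.Product using (Σ; ∃; _×_; _,_)
open import Relation.Nullary.Decidable using (⌊_⌋; _×-dec_)
open import Relation.Binary.PropositionalEquality using (_≡_)

-- Polynomials in ℤ[q], as coefficient lists (constant term first).
Poly : Set
Poly = List ℤ

coeff : Poly → ℕ → ℤ
coeff []       _       = + 0
coeff (a ∷ p)  zero    = a
coeff (a ∷ p)  (suc k) = coeff p k

-- Equality of polynomials (coefficientwise; trailing zeros irrelevant).
infix 4 _≈P_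
_≈P_ : Poly → Poly → Set
p ≈P r = ∀ k → coeff p k ≡ coeff r k

infixl 6 _+P_
_+P_ : Poly → Poly → Poly
[]      +P r       = r
(a ∷ p) +P []      = a ∷ p
(a ∷ p) +P (b ∷ r) = (a + b) ∷ (p +P r)

scaleP : ℤ → Poly → Poly
scaleP c []      = []
scaleP c (a ∷ p) = (c * a) ∷ scaleP c p

infixl 7 _*P_
_*P_ : Poly → Poly → Poly
[]      *P r = []
(a ∷ p) *P r = scaleP a r +P (+ 0 ∷ (p *P r))

infix 4 _∣P_
_∣P_ : Poly → Poly → Set
p ∣P m = Σ Poly λ r → m ≈P p *P r

-- p(q) ↦ p(q^d)   (used for d ≥ 1)
expand : ℕ → Poly → Poly
expand d []      = []
expand d (a ∷ p) = a ∷ (replicate (d N.∸ 1) (+ 0) ++ expand d p)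

qint : ℕ → Poly
qint n = replicate n (+ 1)

sgn : ℕ → ℤ
sgn zero    = + 1
sgn (suc k) = - sgn k

hasSquareFactor : ℕ → Bool
hasSquareFactor n = any (λ k → ⌊ 2 ≤? k ⌋ ∧ ⌊ (k N.* k) ∣? n ⌋) (upTo (suc n))

ω : ℕ → ℕ
ω n = length (filter (λ p → prime? p ×-dec (p ∣? n)) (upTo (suc n)))

μ : ℕ → ℤ
μ n = if hasSquareFactor n then + 0 else sgn (ω n)

-- Σ_{d ∣ n} f d (n/d), for n ≥ 1 (d ranges over 1..n)
divSum : ℕ → (ℕ → ℕ → Poly) → Poly
divSum n f = foldr (λ k acc → if ⌊ suc k ∣? n ⌋ then f (suc k) (n / suc k) +P acc else acc)
                   [] (upTo n)

-- Sequences (a_n)_{n ≥ 1} in ℤ[q]; the value at index 0 is ignored.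
IsQGauss : (ℕ → Poly) → Set
IsQGauss a = ∀ n → 1 ≤ n →
  qint n ∣P divSum n (λ d m → scaleP (μ d) (expand d (a m)))

-- Write E_d p(q) = p(q^d), T a_n = Σ_{dm=n} μ(d) E_d a_m (so a is q-Gauss iff [n]_q divides T a_n)
-- and U h_n = Σ_{dm=n} E_d h_m. Since E_d E_e = E_{de}, both T (U h)_n and U (T a)_n unfold to sums
-- over the factorisations n = d e k, which Σ_{d∣c} μ(d) = [c = 1] collapses to h_n, resp. a_n:
-- T and U are mutually inverse. As E_d is multiplicative, the expansion in the statement says
-- a = U h with h_m = [m]_q g_m, which therefore holds iff T a_n = [n]_q g_n for all n.
module Submission where

open import Defs
open import Data.Bool using (Bool; true; false; T; _∧_; if_then_else_)
open import Data.Bool.Properties using (T-≡; T-∧; ⇔→≡)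
open import Data.Empty using (⊥-elim)
open import Data.Integer using (ℤ; +_; -_; _+_; _*_)
open import Data.Integer.Properties
  using (+-identityʳ; +-identityˡ; +-assoc; +-inverseˡ; +-injective; pos-+; *-zeroˡ; *-zeroʳ; *-identityˡ; *-distribʳ-+; *-distribˡ-+)
open import Data.Integer.Solver using (module +-*-Solver)
open import Data.List using ([]; _∷_; [_]; _++_; replicate; upTo; filter; length; foldr)
open import Data.List.Membership.Propositional using (find; lose)
open import Data.List.Membership.Propositional.Properties using (∈-upTo⁺)
open import Data.List.Properties using (upTo-∷ʳ; filter-++; length-++; foldr-++)
open import Data.List.Relation.Unary.All using (_∷_)
open import Data.List.Relation.Unary.Any.Properties using (any⁺; any⁻)
open import Data.Nat as ℕ using (ℕ; zero; suc; _∸_; _≤_; _<_; z≤n; s≤s; _≤?_; _≟_; >-nonZero; >-nonZero⁻¹; nonTrivial⇒n>1)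
open import Data.Nat.Coprimality using (Coprime; coprime-divisor)
open import Data.Nat.Divisibility
  using (_∣_; _∣?_; divides; 1∣_; ∣⇒≤; ∣-trans; *-pres-∣; *-monoʳ-∣; *-cancelˡ-∣; m*n∣⇒m∣; ∣n⇒∣m*n; m∣m*n)
open import Data.Nat.DivMod using (_/_; m*[n/m]≡n; m/n/o≡m/[n*o]; m*n/n≡m; m≥n⇒m/n>0; n/1≡n)
open import Data.Nat.ListAction using (product)
open import Data.Nat.Primality
  using (Prime; prime?; euclidsLemma; prime⇒irreducible; prime⇒nonZero; prime⇒nonTrivial; ¬prime[0]; ¬prime[1])
open import Data.Nat.Primality.Factorisation using (factorise)
open import Data.Nat.Properties
  using (≤-refl; ≤-trans; ≤-pred; ≤-reflexive; n≤1+n; 1+n≰n; <-irrefl; m<n⇒m<1+n; m≤n⇒m<n∨m≡n; ≤∧≢⇒<;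
         *-comm; *-cancelˡ-≡; suc-injective; m≤m*n; m≤n*m; m*n≢0⇒n≢0)
open import Data.Product using (Σ; ∃-syntax; _×_; _,_; proj₁; proj₂)
open import Data.Sum using (inj₁; inj₂; [_,_]′)
open import Function using (_⇔_; mk⇔; Equivalence; id)
import Function.Properties.Equivalence as ⇔
open import Relation.Binary.Bundles using (Setoid)
import Relation.Binary.Reasoning.Setoid
open import Relation.Binary.PropositionalEquality using (_≡_; _≢_; refl; sym; trans; cong; cong₂; subst; module ≡-Reasoning)
open import Relation.Nullary using (Dec; yes; no; ¬_)
open import Relation.Nullary.Decidable using (¬?; ⌊_⌋; toWitness; fromWitness; _×-dec_)
open import Relation.Unary using (Decidable)

open +-*-Solver using (solve; _:+_; _:=_)

infixr 8 [_]·_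
[_]·_ : ∀ {ℓ} {P : Set ℓ} → Dec P → ℤ → ℤ
[ yes _ ]· x = x
[ no  _ ]· x = + 0

module _ {ℓ} {P : Set ℓ} where

  []·-yes : (D : Dec P) {x : ℤ} → P → [ D ]· x ≡ x
  []·-yes (yes _) _ = refl
  []·-yes (no ¬p) p = ⊥-elim (¬p p)

  []·-no : (D : Dec P) {x : ℤ} → ¬ P → [ D ]· x ≡ + 0
  []·-no (yes p) ¬p = ⊥-elim (¬p p)
  []·-no (no _)  _  = refl

  []·-zero : (D : Dec P) → [ D ]· + 0 ≡ + 0
  []·-zero (yes _) = refl
  []·-zero (no _)  = refl

  []·-cong : (D : Dec P) {x y : ℤ} → (P → x ≡ y) → [ D ]· x ≡ [ D ]· y
  []·-cong (yes p) x≡y = x≡y p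
  []·-cong (no _)  _   = refl

  []·-*ʳ : (D : Dec P) (x y : ℤ) → [ D ]· (x * y) ≡ ([ D ]· x) * y
  []·-*ʳ (yes _) x y = refl
  []·-*ʳ (no _)  x y = sym (*-zeroˡ y)

  []·-*ˡ : (D : Dec P) (x y : ℤ) → x * [ D ]· y ≡ [ D ]· (x * y)
  []·-*ˡ (yes _) x y = refl
  []·-*ˡ (no _)  x y = *-zeroʳ x

  []·-neg : (D : Dec P) (x : ℤ) → [ D ]· (- x) ≡ - [ D ]· x
  []·-neg (yes _) x = refl
  []·-neg (no _)  x = refl

  []·-split : (D : Dec P) (x : ℤ) → x ≡ [ D ]· x + [ ¬? D ]· x
  []·-split (yes _) x = sym (+-identityʳ x)
  []·-split (no _)  x = sym (+-identityˡ x)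

[]·-⇔ : ∀ {ℓ ℓ′} {P : Set ℓ} {Q : Set ℓ′} (D : Dec P) (E : Dec Q) {x : ℤ} →
        (P → Q) → (Q → P) → [ D ]· x ≡ [ E ]· x
[]·-⇔ (yes p) (yes q) to from = refl
[]·-⇔ (yes p) (no ¬q) to from = ⊥-elim (¬q (to p))
[]·-⇔ (no ¬p) (yes q) to from = ⊥-elim (¬p (from q))
[]·-⇔ (no _)  (no _)  to from = refl

[]·-comm : ∀ {ℓ ℓ′} {P : Set ℓ} {Q : Set ℓ′} (D : Dec P) (E : Dec Q) (x : ℤ) →
           [ D ]· [ E ]· x ≡ [ E ]· [ D ]· x
[]·-comm (yes _) (yes _) x = refl
[]·-comm (yes _) (no _)  x = refl
[]·-comm (no _)  (yes _) x = refl
[]·-comm (no _)  (no _)  x = refl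

∑< : ℕ → (ℕ → ℤ) → ℤ
∑< zero    f = + 0
∑< (suc n) f = ∑< n f + f n

infixr 5 ∑<
syntax ∑< n (λ k → e) = ∑[ k < n ] e

∑<-cong : ∀ n {f g : ℕ → ℤ} → (∀ k → k < n → f k ≡ g k) → ∑< n f ≡ ∑< n g
∑<-cong zero    f≡g = refl
∑<-cong (suc n) f≡g = cong₂ _+_ (∑<-cong n (λ k k<n → f≡g k (m<n⇒m<1+n k<n))) (f≡g n ≤-refl)

∑<-zero : ∀ n {f : ℕ → ℤ} → (∀ k → k < n → f k ≡ + 0) → ∑< n f ≡ + 0
∑<-zero zero    f≡0 = refl
∑<-zero (suc n) f≡0 = cong₂ _+_ (∑<-zero n (λ k k<n → f≡0 k (m<n⇒m<1+n k<n))) (f≡0 n ≤-refl)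

∑<-+ : ∀ n (f g : ℕ → ℤ) → ∑[ k < n ] (f k + g k) ≡ ∑< n f + ∑< n g
∑<-+ zero    f g = refl
∑<-+ (suc n) f g = trans (cong (_+ (f n + g n)) (∑<-+ n f g))
  (solve 4 (λ F G x y → (F :+ G) :+ (x :+ y) := (F :+ x) :+ (G :+ y)) refl (∑< n f) (∑< n g) (f n) (g n))

∑<-*ʳ : ∀ n (f : ℕ → ℤ) (c : ℤ) → ∑[ k < n ] (f k * c) ≡ ∑< n f * c
∑<-*ʳ zero    f c = refl
∑<-*ʳ (suc n) f c = trans (cong (_+ f n * c) (∑<-*ʳ n f c)) (sym (*-distribʳ-+ c (∑< n f) (f n)))

∑<-*ˡ : ∀ n (c : ℤ) (f : ℕ → ℤ) → c * ∑< n f ≡ ∑[ k < n ] (c * f k)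
∑<-*ˡ zero    c f = *-zeroʳ c
∑<-*ˡ (suc n) c f = trans (*-distribˡ-+ c (∑< n f) (f n)) (cong (_+ c * f n) (∑<-*ˡ n c f))

∑<-extend : ∀ {m} n {f : ℕ → ℤ} → m ≤ n → (∀ k → m ≤ k → k < n → f k ≡ + 0) → ∑< m f ≡ ∑< n f
∑<-extend zero    z≤n _ = refl
∑<-extend {m} (suc n) {f} m≤1+n f≡0 with m≤n⇒m<n∨m≡n m≤1+n
... | inj₂ refl      = refl
... | inj₁ (s≤s m≤n) = begin
  ∑< m f          ≡⟨ ∑<-extend n m≤n (λ k m≤k k<n → f≡0 k m≤k (m<n⇒m<1+n k<n)) ⟩
  ∑< n f          ≡⟨ sym (+-identityʳ (∑< n f)) ⟩
  ∑< n f + + 0    ≡⟨ cong (λ z → ∑< n f + z) (sym (f≡0 n m≤n ≤-refl)) ⟩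
  ∑< n f + f n    ∎
  where open ≡-Reasoning

∑<-single : ∀ n i {f : ℕ → ℤ} → i < n → (∀ k → k < n → k ≢ i → f k ≡ + 0) → ∑< n f ≡ f i
∑<-single (suc n) i {f} i<1+n f≡0 with i ℕ.≟ n
... | yes refl = begin
  ∑< n f + f n  ≡⟨ cong (_+ f n) (∑<-zero n (λ k k<n → f≡0 k (m<n⇒m<1+n k<n) (λ { refl → <-irrefl refl k<n }))) ⟩
  + 0 + f n     ≡⟨ +-identityˡ (f n) ⟩
  f n           ∎
  where open ≡-Reasoning
... | no i≢n = begin
  ∑< n f + f n  ≡⟨ cong₂ _+_ (∑<-single n i (≤∧≢⇒< (≤-pred i<1+n) i≢n) (λ k k<n → f≡0 k (m<n⇒m<1+n k<n)))
                             (f≡0 n ≤-refl (λ n≡i → i≢n (sym n≡i))) ⟩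
  f i + + 0     ≡⟨ +-identityʳ (f i) ⟩
  f i           ∎
  where open ≡-Reasoning

∑<-comm : ∀ m n (F : ℕ → ℕ → ℤ) → ∑[ i < m ] ∑< n (F i) ≡ ∑[ j < n ] ∑[ i < m ] F i j
∑<-comm zero    n F = sym (∑<-zero n (λ _ _ → refl))
∑<-comm (suc m) n F = trans (cong (_+ ∑< n (F m)) (∑<-comm m n F)) (sym (∑<-+ n (λ j → ∑[ i < m ] F i j) (F m)))

[]·-≤?-suc : ∀ x N (y : ℤ) → [ x ≤? suc N ]· y ≡ [ x ≤? N ]· y + [ x ≟ suc N ]· y
[]·-≤?-suc x N y with x ≤? N | x ≟ suc N
... | yes x≤N | yes refl = ⊥-elim (1+n≰n x≤N)
... | yes x≤N | no _  = trans ([]·-yes (x ≤? suc N) (≤-trans x≤N (n≤1+n N))) (sym (+-identityʳ y))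
... | no _    | yes refl = trans ([]·-yes (x ≤? suc N) ≤-refl) (sym (+-identityˡ y))
... | no x≰N  | no x≢1+N =
  []·-no (x ≤? suc N) (λ x≤1+N → [ (λ x<1+N → x≰N (≤-pred x<1+N)) , x≢1+N ]′ (m≤n⇒m<n∨m≡n x≤1+N))

∑<-unique-multiple : ∀ d {K} N → suc N ≤ K → (ψ : ℕ → ℤ) →
  ∑[ b < K ] [ suc d ℕ.* suc b ≟ suc N ]· ψ (suc d ℕ.* suc b) ≡ [ suc d ∣? suc N ]· ψ (suc N)
∑<-unique-multiple d {K} N N<K ψ with suc d ∣? suc N
... | no d∤1+N = ∑<-zero K (λ b _ → []·-no (suc d ℕ.* suc b ≟ suc N)
                   (λ db≡1+N → d∤1+N (divides (suc b) (trans (sym db≡1+N) (*-comm (suc d) (suc b))))))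
... | yes (divides (suc b₀) 1+N≡b₀d) = begin
  ∑[ b < K ] [ suc d ℕ.* suc b ≟ suc N ]· ψ (suc d ℕ.* suc b)  ≡⟨ ∑<-single K b₀ b₀<K others ⟩
  [ suc d ℕ.* suc b₀ ≟ suc N ]· ψ (suc d ℕ.* suc b₀)           ≡⟨ []·-yes (suc d ℕ.* suc b₀ ≟ suc N) db₀≡1+N ⟩
  ψ (suc d ℕ.* suc b₀)                                          ≡⟨ cong ψ db₀≡1+N ⟩
  ψ (suc N)                                                     ∎
  where
  open ≡-Reasoning
  db₀≡1+N : suc d ℕ.* suc b₀ ≡ suc N
  db₀≡1+N = trans (*-comm (suc d) (suc b₀)) (sym 1+N≡b₀d)
  b₀<K : b₀ < K
  b₀<K = ≤-trans (≤-trans (m≤m*n (suc b₀) (suc d)) (≤-reflexive (sym 1+N≡b₀d))) N<K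
  others : ∀ b → b < K → b ≢ b₀ → [ suc d ℕ.* suc b ≟ suc N ]· ψ (suc d ℕ.* suc b) ≡ + 0
  others b _ b≢b₀ = []·-no (suc d ℕ.* suc b ≟ suc N)
    (λ db≡1+N → b≢b₀ (suc-injective (*-cancelˡ-≡ (suc b) (suc b₀) (suc d) (trans db≡1+N (sym db₀≡1+N)))))

∑<-multiples : ∀ d {K} N → N ≤ K → (ψ : ℕ → ℤ) →
  ∑[ c < N ] [ suc d ∣? suc c ]· ψ (suc c) ≡ ∑[ b < K ] [ suc d ℕ.* suc b ≤? N ]· ψ (suc d ℕ.* suc b)
∑<-multiples d {K} zero    _   ψ = sym (∑<-zero K (λ b _ → []·-no (suc d ℕ.* suc b ≤? 0) {ψ (suc d ℕ.* suc b)} (λ ())))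
∑<-multiples d {K} (suc N) N<K ψ = begin
  (∑[ c < N ] [ suc d ∣? suc c ]· ψ (suc c)) + [ suc d ∣? suc N ]· ψ (suc N)
    ≡⟨ cong₂ _+_ (∑<-multiples d N (≤-trans (n≤1+n N) N<K) ψ) (sym (∑<-unique-multiple d N N<K ψ)) ⟩
  (∑[ b < K ] [ suc d ℕ.* suc b ≤? N ]· ψ (suc d ℕ.* suc b)) + (∑[ b < K ] [ suc d ℕ.* suc b ≟ suc N ]· ψ (suc d ℕ.* suc b))
    ≡⟨ sym (∑<-+ K _ _) ⟩
  ∑[ b < K ] ([ suc d ℕ.* suc b ≤? N ]· ψ (suc d ℕ.* suc b) + [ suc d ℕ.* suc b ≟ suc N ]· ψ (suc d ℕ.* suc b))
    ≡⟨ ∑<-cong K (λ b _ → sym ([]·-≤?-suc (suc d ℕ.* suc b) N _)) ⟩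
  ∑[ b < K ] [ suc d ℕ.* suc b ≤? suc N ]· ψ (suc d ℕ.* suc b)
    ∎
  where open ≡-Reasoning

infixr 5 ∑∣ ∑∣³
syntax ∑∣ n (λ d m → e) = ∑[ d * m ≡ n ] e
syntax ∑∣³ n (λ d e k → x) = ∑[ d * e * k ≡ n ] x

-- Opaque, so that the summand f of ∑∣ n f can be recovered from the type by unification.
opaque
  ∑∣ : ℕ → (ℕ → ℕ → ℤ) → ℤ
  ∑∣ n f = ∑[ a < n ] [ suc a ∣? n ]· f (suc a) (n / suc a)

  ∑∣-cong : ∀ n {f g : ℕ → ℕ → ℤ} → (∀ d m → suc d ℕ.* m ≡ n → f (suc d) m ≡ g (suc d) m) → ∑∣ n f ≡ ∑∣ n g
  ∑∣-cong n f≡g = ∑<-cong n (λ a _ → []·-cong (suc a ∣? n) (λ a∣n → f≡g a _ (m*[n/m]≡n a∣n)))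

  ∑∣-*ˡ : ∀ n (c : ℤ) (f : ℕ → ℕ → ℤ) → c * ∑∣ n f ≡ ∑[ d * m ≡ n ] (c * f d m)
  ∑∣-*ˡ n c f = trans (∑<-*ˡ n c _) (∑<-cong n (λ a _ → []·-*ˡ (suc a ∣? n) c _))

  ∑∣-*ʳ : ∀ n (f : ℕ → ℕ → ℤ) (c : ℤ) → ∑[ d * m ≡ n ] (f d m * c) ≡ ∑∣ n f * c
  ∑∣-*ʳ n f c = trans (∑<-cong n (λ a _ → []·-*ʳ (suc a ∣? n) _ c)) (∑<-*ʳ n _ c)

  ∑∣³ : ℕ → (ℕ → ℕ → ℕ → ℤ) → ℤ
  ∑∣³ n F = ∑[ a < n ] ∑[ b < n ] [ suc a ℕ.* suc b ∣? n ]· F (suc a) (suc b) (n / (suc a ℕ.* suc b))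

  ∑∣-assocˡ : ∀ n (F : ℕ → ℕ → ℕ → ℤ) → ∑[ d * m ≡ n ] ∑[ e * k ≡ m ] F d e k ≡ ∑[ d * e * k ≡ n ] F d e k
  ∑∣-assocˡ zero        F = refl
  ∑∣-assocˡ n@(suc _)   F = ∑<-cong n (λ a _ → inner a (suc a ∣? n))
    where
    inner : ∀ a → (a∣n? : Dec (suc a ∣ n)) →
      [ a∣n? ]· (∑[ e * k ≡ n / suc a ] F (suc a) e k)
      ≡ ∑[ b < n ] [ suc a ℕ.* suc b ∣? n ]· F (suc a) (suc b) (n / (suc a ℕ.* suc b))
    inner a (no a∤n) =
      sym (∑<-zero n (λ b _ → []·-no (suc a ℕ.* suc b ∣? n) (λ ab∣n → a∤n (m*n∣⇒m∣ (suc a) (suc b) ab∣n))))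
    inner a (yes a∣n) = trans (∑<-extend n m≤n beyond) (∑<-cong n (λ b _ → term b))
      where
      m : ℕ
      m = n / suc a
      am≡n : suc a ℕ.* m ≡ n
      am≡n = m*[n/m]≡n a∣n
      instance
        m≢0 : ℕ.NonZero m
        m≢0 = >-nonZero (m≥n⇒m/n>0 (∣⇒≤ a∣n))
      m≤n : m ≤ n
      m≤n = ≤-trans (m≤m*n m (suc a)) (≤-reflexive (trans (*-comm m (suc a)) am≡n))
      beyond : ∀ b → m ≤ b → b < n → [ suc b ∣? m ]· F (suc a) (suc b) (m / suc b) ≡ + 0
      beyond b m≤b _ = []·-no (suc b ∣? m) (λ b∣m → 1+n≰n (≤-trans (s≤s m≤b) (∣⇒≤ b∣m)))
      term : ∀ b → [ suc b ∣? m ]· F (suc a) (suc b) (m / suc b)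
                 ≡ [ suc a ℕ.* suc b ∣? n ]· F (suc a) (suc b) (n / (suc a ℕ.* suc b))
      term b = trans (cong (λ k → [ suc b ∣? m ]· F (suc a) (suc b) k) (m/n/o≡m/[n*o] n (suc a) (suc b)))
                     ([]·-⇔ (suc b ∣? m) (suc a ℕ.* suc b ∣? n)
                        (λ b∣m → subst (suc a ℕ.* suc b ∣_) am≡n (*-monoʳ-∣ (suc a) b∣m))
                        (λ ab∣n → *-cancelˡ-∣ (suc a) (subst (suc a ℕ.* suc b ∣_) (sym am≡n) ab∣n)))

  ∑∣-assocʳ : ∀ n (F : ℕ → ℕ → ℕ → ℤ) → ∑[ c * k ≡ n ] ∑[ d * e ≡ c ] F d e k ≡ ∑[ d * e * k ≡ n ] F d e k
  ∑∣-assocʳ zero      F = refl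
  ∑∣-assocʳ n@(suc _) F = begin
    ∑[ c < n ] [ suc c ∣? n ]· (∑[ a < suc c ] [ suc a ∣? suc c ]· F (suc a) (suc c / suc a) (n / suc c))
      ≡⟨ ∑<-cong n (λ c _ → widen c (suc c ∣? n)) ⟩
    ∑[ c < n ] ∑[ a < n ] [ suc c ∣? n ]· [ suc a ∣? suc c ]· F (suc a) (suc c / suc a) (n / suc c)
      ≡⟨ ∑<-comm n n _ ⟩
    ∑[ a < n ] ∑[ c < n ] [ suc c ∣? n ]· [ suc a ∣? suc c ]· F (suc a) (suc c / suc a) (n / suc c)
      ≡⟨ ∑<-cong n (λ a _ → ∑<-cong n (λ c _ → []·-comm (suc c ∣? n) (suc a ∣? suc c) _)) ⟩
    ∑[ a < n ] ∑[ c < n ] [ suc a ∣? suc c ]· ψ a (suc c)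
      ≡⟨ ∑<-cong n (λ a _ → ∑<-multiples a n ≤-refl (ψ a)) ⟩
    ∑[ a < n ] ∑[ b < n ] [ suc a ℕ.* suc b ≤? n ]· ψ a (suc a ℕ.* suc b)
      ≡⟨ ∑<-cong n (λ a _ → ∑<-cong n (λ b _ → multiple a b (suc a ℕ.* suc b ∣? n))) ⟩
    ∑[ d * e * k ≡ n ] F d e k
      ∎
    where
    open ≡-Reasoning
    -- By cases on the argument, so that n / x needs no NonZero x instance.
    ψ : ℕ → ℕ → ℤ
    ψ a zero    = + 0
    ψ a (suc c) = [ suc c ∣? n ]· F (suc a) (suc c / suc a) (n / suc c)
    widen : ∀ c → (c∣n? : Dec (suc c ∣ n)) →
      [ c∣n? ]· (∑[ a < suc c ] [ suc a ∣? suc c ]· F (suc a) (suc c / suc a) (n / suc c))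
      ≡ ∑[ a < n ] [ c∣n? ]· [ suc a ∣? suc c ]· F (suc a) (suc c / suc a) (n / suc c)
    widen c (no _)    = sym (∑<-zero n (λ _ _ → refl))
    widen c (yes c∣n) =
      ∑<-extend n (∣⇒≤ c∣n) (λ a c<a _ → []·-no (suc a ∣? suc c) (λ a∣c → 1+n≰n (≤-trans (s≤s c<a) (∣⇒≤ a∣c))))
    multiple : ∀ a b → (ab∣n? : Dec (suc a ℕ.* suc b ∣ n)) →
      [ suc a ℕ.* suc b ≤? n ]· [ ab∣n? ]· F (suc a) (suc a ℕ.* suc b / suc a) (n / (suc a ℕ.* suc b))
      ≡ [ ab∣n? ]· F (suc a) (suc b) (n / (suc a ℕ.* suc b))
    multiple a b (yes ab∣n) = trans ([]·-yes (suc a ℕ.* suc b ≤? n) (∣⇒≤ ab∣n))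
                                    (cong (λ e → F (suc a) e (n / (suc a ℕ.* suc b))) ab/a≡b)
      where
      ab/a≡b : suc a ℕ.* suc b / suc a ≡ suc b
      ab/a≡b = trans (cong (_/ suc a) (*-comm (suc a) (suc b))) (m*n/n≡m (suc b) (suc a))
    multiple a b (no _)     = []·-zero (suc a ℕ.* suc b ≤? n)

  ∑∣³-comm : ∀ n (F : ℕ → ℕ → ℕ → ℤ) → ∑[ d * e * k ≡ n ] F d e k ≡ ∑[ d * e * k ≡ n ] F e d k
  ∑∣³-comm n F = trans (∑<-comm n n _) (∑<-cong n (λ b _ → ∑<-cong n (λ a _ → swap a b)))
    where
    swap : ∀ a b → [ suc a ℕ.* suc b ∣? n ]· F (suc a) (suc b) (n / (suc a ℕ.* suc b))
                 ≡ [ suc b ℕ.* suc a ∣? n ]· F (suc a) (suc b) (n / (suc b ℕ.* suc a))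
    swap a b = cong term (*-comm (suc a) (suc b))
      where
      term : ℕ → ℤ
      term zero    = + 0
      term (suc x) = [ suc x ∣? n ]· F (suc a) (suc b) (n / suc x)

prime∤⇒coprime : ∀ {p m} → Prime p → ¬ p ∣ m → Coprime m p
prime∤⇒coprime {p} pp p∤m (i∣m , i∣p) with prime⇒irreducible pp i∣p
... | inj₁ i≡1 = i≡1
... | inj₂ refl = ⊥-elim (p∤m i∣m)

square∣prime*⇒square∣ : ∀ {p e k} → Prime p → ¬ p ∣ e → k ℕ.* k ∣ p ℕ.* e → k ℕ.* k ∣ e
square∣prime*⇒square∣ {p} {e} {k} pp p∤e kk∣pe = coprime-divisor (prime∤⇒coprime pp p∤kk) kk∣pe
  where
  instance
    p≢0 : ℕ.NonZero p
    p≢0 = prime⇒nonZero pp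
  p∤kk : ¬ p ∣ k ℕ.* k
  p∤kk p∣kk = p∤e (*-cancelˡ-∣ p (∣-trans (*-pres-∣ p∣k p∣k) kk∣pe))
    where
    p∣k : p ∣ k
    p∣k = [ id , id ]′ (euclidsLemma k k pp p∣kk)

HasSquareFactor : ℕ → Set
HasSquareFactor n = ∃[ k ] 2 ≤ k × k ℕ.* k ∣ n

hasSquareFactor⇔ : ∀ {n} → 1 ≤ n → hasSquareFactor n ≡ true ⇔ HasSquareFactor n
hasSquareFactor⇔ {n} n≥1 = mk⇔ to from
  where
  instance
    n≢0 : ℕ.NonZero n
    n≢0 = >-nonZero n≥1
  squareFactor? : ℕ → Bool
  squareFactor? k = ⌊ 2 ≤? k ⌋ ∧ ⌊ k ℕ.* k ∣? n ⌋
  to : hasSquareFactor n ≡ true → HasSquareFactor n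
  to hsf with k , _ , sq ← find (any⁻ squareFactor? (upTo (suc n)) (Equivalence.from T-≡ hsf))
    with 2≤k , kk∣n ← Equivalence.to (T-∧ {⌊ 2 ≤? k ⌋}) sq = k , toWitness 2≤k , toWitness {a? = k ℕ.* k ∣? n} kk∣n
  from : HasSquareFactor n → hasSquareFactor n ≡ true
  from (k , 2≤k , kk∣n) = Equivalence.to T-≡ (any⁺ squareFactor? (lose (∈-upTo⁺ k<1+n) sq))
    where
    sq : T (squareFactor? k)
    sq = Equivalence.from (T-∧ {⌊ 2 ≤? k ⌋}) (fromWitness 2≤k , fromWitness kk∣n)
    k<1+n : k < suc n
    k<1+n = s≤s (≤-trans (m≤m*n k k {{>-nonZero (≤-trans (s≤s z≤n) 2≤k)}}) (∣⇒≤ kk∣n))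

hasSquareFactor-prime* : ∀ {p e} → Prime p → ¬ p ∣ e → 1 ≤ e → hasSquareFactor (p ℕ.* e) ≡ hasSquareFactor e
hasSquareFactor-prime* {p} {e} pp p∤e e≥1 =
  ⇔→≡ {z = true} (⇔.trans (hasSquareFactor⇔ pe≥1) (⇔.trans (mk⇔ down up) (⇔.sym (hasSquareFactor⇔ e≥1))))
  where
  instance
    p≢0 : ℕ.NonZero p
    p≢0 = prime⇒nonZero pp
  pe≥1 : 1 ≤ p ℕ.* e
  pe≥1 = ≤-trans e≥1 (m≤n*m e p)
  down : HasSquareFactor (p ℕ.* e) → HasSquareFactor e
  down (k , 2≤k , kk∣pe) = k , 2≤k , square∣prime*⇒square∣ {k = k} pp p∤e kk∣pe
  up : HasSquareFactor e → HasSquareFactor (p ℕ.* e)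
  up (k , 2≤k , kk∣e) = k , 2≤k , ∣n⇒∣m*n p kk∣e

count≡∑ : ∀ {P : ℕ → Set} (P? : Decidable P) n → + length (filter P? (upTo n)) ≡ ∑[ k < n ] [ P? k ]· + 1
count≡∑ P? zero    = refl
count≡∑ P? (suc n) = begin
  + length (filter P? (upTo (suc n)))                        ≡⟨ cong (λ ks → + length (filter P? ks)) (sym (upTo-∷ʳ n)) ⟩
  + length (filter P? (upTo n ++ [ n ]))                     ≡⟨ cong (λ ks → + length ks) (filter-++ P? (upTo n) [ n ]) ⟩
  + length (filter P? (upTo n) ++ filter P? [ n ])           ≡⟨ cong +_ (length-++ (filter P? (upTo n))) ⟩
  + (length (filter P? (upTo n)) ℕ.+ length (filter P? [ n ])) ≡⟨ pos-+ (length (filter P? (upTo n))) (length (filter P? [ n ])) ⟩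
  + length (filter P? (upTo n)) + + length (filter P? [ n ])  ≡⟨ cong₂ _+_ (count≡∑ P? n) last ⟩
  (∑[ k < n ] [ P? k ]· + 1) + [ P? n ]· + 1                   ∎
  where
  open ≡-Reasoning
  last : + length (filter P? [ n ]) ≡ [ P? n ]· + 1
  last with P? n
  ... | yes _ = refl
  ... | no _  = refl

primeDivisor? : ∀ n k → Dec (Prime k × k ∣ n)
primeDivisor? n k = prime? k ×-dec k ∣? n

ω-prime* : ∀ {p e} → Prime p → ¬ p ∣ e → 1 ≤ e → ω (p ℕ.* e) ≡ suc (ω e)
ω-prime* {p} {e} pp p∤e e≥1 = +-injective (begin
  + ω (p ℕ.* e)                                                  ≡⟨ count≡∑ (primeDivisor? (p ℕ.* e)) (suc (p ℕ.* e)) ⟩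
  ∑[ k < suc (p ℕ.* e) ] [ primeDivisor? (p ℕ.* e) k ]· + 1     ≡⟨ ∑<-cong (suc (p ℕ.* e)) (λ k _ → split k) ⟩
  ∑[ k < suc (p ℕ.* e) ] ([ k ≟ p ]· + 1 + [ primeDivisor? e k ]· + 1)
                                                                  ≡⟨ ∑<-+ (suc (p ℕ.* e)) _ _ ⟩
  (∑[ k < suc (p ℕ.* e) ] [ k ≟ p ]· + 1) + (∑[ k < suc (p ℕ.* e) ] [ primeDivisor? e k ]· + 1)
                                                                  ≡⟨ cong₂ _+_ onlyP (sym (∑<-extend (suc (p ℕ.* e)) (s≤s (m≤n*m e p)) beyond)) ⟩
  + 1 + (∑[ k < suc e ] [ primeDivisor? e k ]· + 1)              ≡⟨ cong (_+_ (+ 1)) (sym (count≡∑ (primeDivisor? e) (suc e))) ⟩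
  + suc (ω e)                                                     ∎)
  where
  open ≡-Reasoning
  instance
    p≢0 : ℕ.NonZero p
    p≢0 = prime⇒nonZero pp
    e≢0 : ℕ.NonZero e
    e≢0 = >-nonZero e≥1
  split : ∀ k → [ primeDivisor? (p ℕ.* e) k ]· + 1 ≡ [ k ≟ p ]· + 1 + [ primeDivisor? e k ]· + 1
  split k with k ≟ p
  ... | yes refl = trans ([]·-yes (primeDivisor? (p ℕ.* e) k) (pp , m∣m*n e))
                         (cong (_+_ (+ 1)) (sym ([]·-no (primeDivisor? e k) (λ (_ , p∣e) → p∤e p∣e))))
  ... | no k≢p = trans ([]·-⇔ (primeDivisor? (p ℕ.* e) k) (primeDivisor? e k) to from) (sym (+-identityˡ _))
    where
    to : Prime k × k ∣ p ℕ.* e → Prime k × k ∣ e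
    to (pk , k∣pe) with euclidsLemma p e pk k∣pe
    ... | inj₂ k∣e = pk , k∣e
    ... | inj₁ k∣p with prime⇒irreducible pp k∣p
    ...   | inj₁ refl = ⊥-elim (¬prime[1] pk)
    ...   | inj₂ k≡p  = ⊥-elim (k≢p k≡p)
    from : Prime k × k ∣ e → Prime k × k ∣ p ℕ.* e
    from (pk , k∣e) = pk , ∣n⇒∣m*n p k∣e
  onlyP : ∑[ k < suc (p ℕ.* e) ] [ k ≟ p ]· + 1 ≡ + 1
  onlyP = trans (∑<-single (suc (p ℕ.* e)) p (s≤s (m≤m*n p e)) (λ k _ k≢p → []·-no (k ≟ p) k≢p)) ([]·-yes (p ≟ p) refl)
  beyond : ∀ k → suc e ≤ k → k < suc (p ℕ.* e) → [ primeDivisor? e k ]· + 1 ≡ + 0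
  beyond k e<k _ = []·-no (primeDivisor? e k) (λ (_ , k∣e) → 1+n≰n (≤-trans e<k (∣⇒≤ k∣e)))

μ-prime*-∣ : ∀ {p e} → Prime p → p ∣ e → 1 ≤ e → μ (p ℕ.* e) ≡ + 0
μ-prime*-∣ {p} {e} pp p∣e e≥1
  rewrite Equivalence.from (hasSquareFactor⇔ (≤-trans e≥1 (m≤n*m e p {{prime⇒nonZero pp}})))
            (p , nonTrivial⇒n>1 p {{prime⇒nonTrivial pp}} , *-monoʳ-∣ p p∣e) = refl

μ-prime*-∤ : ∀ {p e} → Prime p → ¬ p ∣ e → 1 ≤ e → μ (p ℕ.* e) ≡ - μ e
μ-prime*-∤ {p} {e} pp p∤e e≥1 rewrite hasSquareFactor-prime* pp p∤e e≥1 | ω-prime* pp p∤e e≥1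
  with hasSquareFactor e
... | true  = refl
... | false = refl

μ-prime* : ∀ {p e} → Prime p → 1 ≤ e → μ (p ℕ.* e) ≡ [ ¬? (p ∣? e) ]· (- μ e)
μ-prime* {p} {e} pp e≥1 with p ∣? e
... | yes p∣e = μ-prime*-∣ pp p∣e e≥1
... | no p∤e  = μ-prime*-∤ pp p∤e e≥1

prime-divisor : ∀ {n} → 2 ≤ n → ∃[ p ] Prime p × p ∣ n
prime-divisor {n@(suc _)} 2≤n with factorise n
... | record { factors = [] ; isFactorisation = n≡1 } = ⊥-elim (1+n≰n (subst (2 ≤_) n≡1 2≤n))
... | record { factors = p ∷ ps ; isFactorisation = n≡p*ps ; factorsPrime = pp ∷ _ } =
  p , pp , subst (p ∣_) (sym n≡p*ps) (m∣m*n (product ps))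

-- A divisor of n = p m is either p b with b ∣ m, where μ (p b) is - μ b if p ∤ b and 0 otherwise,
-- or prime to p, hence a b ∣ m with p ∤ b: the two parts cancel.
opaque
  unfolding ∑∣
  prime∣⇒∑∣μ≡0 : ∀ {n} p → Prime (suc p) → suc p ∣ n → ∑[ d * _ ≡ n ] μ d ≡ + 0
  prime∣⇒∑∣μ≡0 {zero}      p pp p∣n = refl
  prime∣⇒∑∣μ≡0 {n@(suc _)} p pp p∣n = begin
    ∑[ a < n ] X a
      ≡⟨ ∑<-cong n (λ a _ → []·-split (P ∣? suc a) (X a)) ⟩
    ∑[ a < n ] ([ P ∣? suc a ]· X a + [ ¬? (P ∣? suc a) ]· X a)
      ≡⟨ ∑<-+ n _ _ ⟩
    (∑[ a < n ] [ P ∣? suc a ]· X a) + (∑[ a < n ] [ ¬? (P ∣? suc a) ]· X a)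
      ≡⟨ cong₂ _+_ (∑<-multiples p n ≤-refl (λ d → [ d ∣? n ]· μ d)) (∑<-cong n (λ a _ → coprimeTerm a)) ⟩
    (∑[ b < n ] [ P ℕ.* suc b ≤? n ]· [ P ℕ.* suc b ∣? n ]· μ (P ℕ.* suc b)) + (∑[ b < n ] Y b (μ (suc b)))
      ≡⟨ cong (_+ (∑[ b < n ] Y b (μ (suc b)))) (∑<-cong n (λ b _ → multipleTerm b)) ⟩
    (∑[ b < n ] Y b (- μ (suc b))) + (∑[ b < n ] Y b (μ (suc b)))
      ≡⟨ sym (∑<-+ n _ _) ⟩
    ∑[ b < n ] (Y b (- μ (suc b)) + Y b (μ (suc b)))
      ≡⟨ ∑<-zero n (λ b _ → cancel b) ⟩
    + 0 ∎
    where
    open ≡-Reasoning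
    P : ℕ
    P = suc p
    m : ℕ
    m = n / P
    Pm≡n : P ℕ.* m ≡ n
    Pm≡n = m*[n/m]≡n p∣n
    X : ℕ → ℤ
    X a = [ suc a ∣? n ]· μ (suc a)
    Y : ℕ → ℤ → ℤ
    Y b x = [ suc b ∣? m ]· [ ¬? (P ∣? suc b) ]· x
    multipleTerm : ∀ b → [ P ℕ.* suc b ≤? n ]· [ P ℕ.* suc b ∣? n ]· μ (P ℕ.* suc b) ≡ Y b (- μ (suc b))
    multipleTerm b with P ℕ.* suc b ∣? n
    ... | no Pb∤n = trans ([]·-zero (P ℕ.* suc b ≤? n))
                          (sym ([]·-no (suc b ∣? m) (λ b∣m → Pb∤n (subst (P ℕ.* suc b ∣_) Pm≡n (*-monoʳ-∣ P b∣m)))))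
    ... | yes Pb∣n = trans ([]·-yes (P ℕ.* suc b ≤? n) (∣⇒≤ Pb∣n))
                           (trans (μ-prime* pp (s≤s z≤n)) (sym ([]·-yes (suc b ∣? m) b∣m)))
      where
      b∣m : suc b ∣ m
      b∣m = *-cancelˡ-∣ P (subst (P ℕ.* suc b ∣_) (sym Pm≡n) Pb∣n)
    coprimeTerm : ∀ a → [ ¬? (P ∣? suc a) ]· X a ≡ Y a (μ (suc a))
    coprimeTerm a with P ∣? suc a
    ... | yes _   = sym ([]·-zero (suc a ∣? m))
    ... | no P∤a = []·-⇔ (suc a ∣? n) (suc a ∣? m)
                     (λ a∣n → coprime-divisor (prime∤⇒coprime pp P∤a) (subst (suc a ∣_) (sym Pm≡n) a∣n))
                     (λ a∣m → subst (suc a ∣_) Pm≡n (∣n⇒∣m*n P a∣m))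
    cancel : ∀ b → Y b (- μ (suc b)) + Y b (μ (suc b)) ≡ + 0
    cancel b = trans (cong (_+ Y b (μ (suc b))) (trans (cong ([ suc b ∣? m ]·_) ([]·-neg (¬? (P ∣? suc b)) (μ (suc b))))
                                                        ([]·-neg (suc b ∣? m) _)))
                     (+-inverseˡ (Y b (μ (suc b))))

∑∣μ≡0 : ∀ {n} → 2 ≤ n → ∑[ d * _ ≡ n ] μ d ≡ + 0
∑∣μ≡0 2≤n with prime-divisor 2≤n
... | suc p , pp , p∣n = prime∣⇒∑∣μ≡0 p pp p∣n
... | zero  , pp , _   = ⊥-elim (¬prime[0] pp)

opaque
  unfolding ∑∣
  ∑∣-[∑∣μ]* : ∀ {n} → 1 ≤ n → (Y : ℕ → ℕ → ℤ) → ∑[ c * k ≡ n ] (∑[ d * _ ≡ c ] μ d) * Y c k ≡ Y 1 n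
  ∑∣-[∑∣μ]* {n} n≥1 Y = begin
    ∑[ c * k ≡ n ] (∑[ d * _ ≡ c ] μ d) * Y c k  ≡⟨ ∑<-single n 0 n≥1 others ⟩
    [ 1 ∣? n ]· (+ 1 * Y 1 (n / 1))               ≡⟨ []·-yes (1 ∣? n) (1∣ n) ⟩
    + 1 * Y 1 (n / 1)                             ≡⟨ *-identityˡ _ ⟩
    Y 1 (n / 1)                                   ≡⟨ cong (Y 1) (n/1≡n n) ⟩
    Y 1 n                                         ∎
    where
    open ≡-Reasoning
    others : ∀ c → c < n → c ≢ 0 → [ suc c ∣? n ]· ((∑[ d * _ ≡ suc c ] μ d) * Y (suc c) (n / suc c)) ≡ + 0
    others zero    _ c≢0 = ⊥-elim (c≢0 refl)
    others (suc c) _ _   = trans (cong (λ s → [ suc (suc c) ∣? n ]· (s * Y (suc (suc c)) (n / suc (suc c))))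
                                       (∑∣μ≡0 {suc (suc c)} (s≤s (s≤s z≤n))))
                                 ([]·-zero (suc (suc c) ∣? n))

möbius-inversionˡ : ∀ {n} → 1 ≤ n → (Y : ℕ → ℕ → ℤ) → ∑[ d * m ≡ n ] ∑[ e * k ≡ m ] μ d * Y (d ℕ.* e) k ≡ Y 1 n
möbius-inversionˡ {n} n≥1 Y = begin
  ∑[ d * m ≡ n ] ∑[ e * k ≡ m ] μ d * Y (d ℕ.* e) k  ≡⟨ ∑∣-assocˡ n F ⟩
  ∑[ d * e * k ≡ n ] μ d * Y (d ℕ.* e) k            ≡⟨ sym (∑∣-assocʳ n F) ⟩
  ∑[ c * k ≡ n ] ∑[ d * e ≡ c ] μ d * Y (d ℕ.* e) k
    ≡⟨ ∑∣-cong n (λ c k _ → ∑∣-cong (suc c) (λ d e de≡c → cong (λ x → μ (suc d) * Y x k) de≡c)) ⟩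
  ∑[ c * k ≡ n ] ∑[ d * _ ≡ c ] μ d * Y c k          ≡⟨ ∑∣-cong n (λ c k _ → ∑∣-*ʳ (suc c) _ (Y (suc c) k)) ⟩
  ∑[ c * k ≡ n ] (∑[ d * _ ≡ c ] μ d) * Y c k        ≡⟨ ∑∣-[∑∣μ]* n≥1 Y ⟩
  Y 1 n                                             ∎
  where
  open ≡-Reasoning
  F : ℕ → ℕ → ℕ → ℤ
  F d e k = μ d * Y (d ℕ.* e) k

möbius-inversionʳ : ∀ {n} → 1 ≤ n → (Y : ℕ → ℕ → ℤ) → ∑[ d * m ≡ n ] ∑[ e * k ≡ m ] μ e * Y (d ℕ.* e) k ≡ Y 1 n
möbius-inversionʳ {n} n≥1 Y = begin
  ∑[ d * m ≡ n ] ∑[ e * k ≡ m ] μ e * Y (d ℕ.* e) k  ≡⟨ ∑∣-assocˡ n F ⟩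
  ∑[ d * e * k ≡ n ] μ e * Y (d ℕ.* e) k            ≡⟨ ∑∣³-comm n F ⟩
  ∑[ d * e * k ≡ n ] μ d * Y (e ℕ.* d) k            ≡⟨ sym (∑∣-assocˡ n (λ d e k → F e d k)) ⟩
  ∑[ d * m ≡ n ] ∑[ e * k ≡ m ] μ d * Y (e ℕ.* d) k
    ≡⟨ ∑∣-cong n (λ d m _ → ∑∣-cong m (λ e k _ → cong (λ x → μ (suc d) * Y x k) (*-comm (suc e) (suc d)))) ⟩
  ∑[ d * m ≡ n ] ∑[ e * k ≡ m ] μ d * Y (d ℕ.* e) k  ≡⟨ möbius-inversionˡ n≥1 Y ⟩
  Y 1 n                                             ∎
  where
  open ≡-Reasoning
  F : ℕ → ℕ → ℕ → ℤ
  F d e k = μ e * Y (d ℕ.* e) k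

-- _≈P_ unfolds to a Π-type from which the compared polynomials cannot be inferred; the record restores inference.
infix 4 _≋_
record _≋_ (p r : Poly) : Set where
  constructor coeffwise
  field coeff-≡ : p ≈P r
open _≋_ public

≋-refl : ∀ {p} → p ≋ p
≋-refl = coeffwise (λ _ → refl)

≋-sym : ∀ {p r} → p ≋ r → r ≋ p
≋-sym (coeffwise p≈r) = coeffwise (λ k → sym (p≈r k))

≋-trans : ∀ {p r s} → p ≋ r → r ≋ s → p ≋ s
≋-trans (coeffwise p≈r) (coeffwise r≈s) = coeffwise (λ k → trans (p≈r k) (r≈s k))

≋-setoid : Setoid _ _
≋-setoid = record { Carrier = Poly ; _≈_ = _≋_ ; isEquivalence = record { refl = ≋-refl ; sym = ≋-sym ; trans = ≋-trans } }

module ≋-Reasoning = Relation.Binary.Reasoning.Setoid ≋-setoid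

coeff-+P : ∀ p r k → coeff (p +P r) k ≡ coeff p k + coeff r k
coeff-+P []      r       k       = sym (+-identityˡ (coeff r k))
coeff-+P (a ∷ p) []      k       = sym (+-identityʳ (coeff (a ∷ p) k))
coeff-+P (a ∷ p) (b ∷ r) zero    = refl
coeff-+P (a ∷ p) (b ∷ r) (suc k) = coeff-+P p r k

coeff-scaleP : ∀ c p k → coeff (scaleP c p) k ≡ c * coeff p k
coeff-scaleP c []      k       = sym (*-zeroʳ c)
coeff-scaleP c (a ∷ p) zero    = refl
coeff-scaleP c (a ∷ p) (suc k) = coeff-scaleP c p k

+P-cong : ∀ {p p′ r r′} → p ≋ p′ → r ≋ r′ → p +P r ≋ p′ +P r′
+P-cong {p} {p′} {r} {r′} (coeffwise p≈p′) (coeffwise r≈r′) =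
  coeffwise (λ k → trans (coeff-+P p r k) (trans (cong₂ _+_ (p≈p′ k) (r≈r′ k)) (sym (coeff-+P p′ r′ k))))

scaleP-cong : ∀ c {p r} → p ≋ r → scaleP c p ≋ scaleP c r
scaleP-cong c {p} {r} (coeffwise p≈r) =
  coeffwise (λ k → trans (coeff-scaleP c p k) (trans (cong (c *_) (p≈r k)) (sym (coeff-scaleP c r k))))

∷-cong : ∀ {a b p r} → a ≡ b → p ≋ r → a ∷ p ≋ b ∷ r
∷-cong a≡b (coeffwise p≈r) = coeffwise λ { zero → a≡b ; (suc k) → p≈r k }

∷-injectiveʳ : ∀ {a b p r} → a ∷ p ≋ b ∷ r → p ≋ r
∷-injectiveʳ (coeffwise ap≈br) = coeffwise (λ k → ap≈br (suc k))

zeros : ℕ → Poly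
zeros k = replicate k (+ 0)

zeros-++-cong : ∀ k {p r} → p ≋ r → zeros k ++ p ≋ zeros k ++ r
zeros-++-cong zero    p≋r = p≋r
zeros-++-cong (suc k) p≋r = ∷-cong refl (zeros-++-cong k p≋r)

∷-≋[] : ∀ {a p} → a ≡ + 0 → p ≋ [] → a ∷ p ≋ []
∷-≋[] a≡0 (coeffwise p≈[]) = coeffwise λ { zero → a≡0 ; (suc k) → p≈[] k }

zeros-++-≋[] : ∀ j {p} → p ≋ [] → zeros j ++ p ≋ []
zeros-++-≋[] zero    p≋[] = p≋[]
zeros-++-≋[] (suc j) p≋[] = ∷-≋[] refl (zeros-++-≋[] j p≋[])

expand-≋[] : ∀ d {p} → p ≋ [] → expand d p ≋ []
expand-≋[] d {[]}    p≋[]  = p≋[]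
expand-≋[] d {a ∷ p} ap≋[] =
  ∷-≋[] (coeff-≡ ap≋[] zero) (zeros-++-≋[] (d ∸ 1) (expand-≋[] d (coeffwise (λ k → coeff-≡ ap≋[] (suc k)))))

expand-cong : ∀ d {p r} → p ≋ r → expand d p ≋ expand d r
expand-cong d {[]}    {[]}    _   = ≋-refl
expand-cong d {[]}    {b ∷ r} p≋r = ≋-sym (expand-≋[] d (≋-sym p≋r))
expand-cong d {a ∷ p} {[]}    p≋r = expand-≋[] d p≋r
expand-cong d {a ∷ p} {b ∷ r} p≋r =
  ∷-cong (coeff-≡ p≋r zero) (zeros-++-cong (d ∸ 1) (expand-cong d (∷-injectiveʳ p≋r)))

+P-[] : ∀ p → p +P [] ≡ p
+P-[] []      = refl
+P-[] (a ∷ p) = refl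

zeros-++-+P : ∀ j p r → (zeros j ++ p) +P (zeros j ++ r) ≡ zeros j ++ (p +P r)
zeros-++-+P zero    p r = refl
zeros-++-+P (suc j) p r = cong (+ 0 ∷_) (zeros-++-+P j p r)

zeros-++-scaleP : ∀ c j p → scaleP c (zeros j ++ p) ≡ zeros j ++ scaleP c p
zeros-++-scaleP c zero    p = refl
zeros-++-scaleP c (suc j) p = cong₂ _∷_ (*-zeroʳ c) (zeros-++-scaleP c j p)

zeros-++-zeros : ∀ i j p → zeros i ++ (zeros j ++ p) ≡ zeros (i ℕ.+ j) ++ p
zeros-++-zeros zero    j p = refl
zeros-++-zeros (suc i) j p = cong (+ 0 ∷_) (zeros-++-zeros i j p)

expand-+P : ∀ d p r → expand d (p +P r) ≡ expand d p +P expand d r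
expand-+P d []      r       = refl
expand-+P d (a ∷ p) []      = sym (+P-[] (expand d (a ∷ p)))
expand-+P d (a ∷ p) (b ∷ r) = cong ((a + b) ∷_) (begin
  zeros (d ∸ 1) ++ expand d (p +P r)                          ≡⟨ cong (zeros (d ∸ 1) ++_) (expand-+P d p r) ⟩
  zeros (d ∸ 1) ++ (expand d p +P expand d r)                 ≡⟨ sym (zeros-++-+P (d ∸ 1) (expand d p) (expand d r)) ⟩
  (zeros (d ∸ 1) ++ expand d p) +P (zeros (d ∸ 1) ++ expand d r) ∎)
  where open ≡-Reasoning

expand-scaleP : ∀ d c p → expand d (scaleP c p) ≡ scaleP c (expand d p)
expand-scaleP d c []      = refl
expand-scaleP d c (a ∷ p) = cong ((c * a) ∷_)
  (trans (cong (zeros (d ∸ 1) ++_) (expand-scaleP d c p)) (sym (zeros-++-scaleP c (d ∸ 1) (expand d p))))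

expand-zeros-++ : ∀ d j p → expand (suc d) (zeros j ++ p) ≡ zeros (j ℕ.* suc d) ++ expand (suc d) p
expand-zeros-++ d zero    p = refl
expand-zeros-++ d (suc j) p = cong (+ 0 ∷_)
  (trans (cong (zeros d ++_) (expand-zeros-++ d j p)) (zeros-++-zeros d (j ℕ.* suc d) (expand (suc d) p)))

expand-expand : ∀ d e p → expand (suc d) (expand (suc e) p) ≡ expand (suc d ℕ.* suc e) p
expand-expand d e p = trans (expand-expand′ p) (cong (λ c → expand c p) (*-comm (suc e) (suc d)))
  where
  open ≡-Reasoning
  expand-expand′ : ∀ p → expand (suc d) (expand (suc e) p) ≡ expand (suc e ℕ.* suc d) p
  expand-expand′ []      = refl
  expand-expand′ (a ∷ p) = cong (a ∷_) (begin
    zeros d ++ expand (suc d) (zeros e ++ expand (suc e) p)             ≡⟨ cong (zeros d ++_) (expand-zeros-++ d e (expand (suc e) p)) ⟩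
    zeros d ++ (zeros (e ℕ.* suc d) ++ expand (suc d) (expand (suc e) p)) ≡⟨ cong (λ q → zeros d ++ (zeros (e ℕ.* suc d) ++ q)) (expand-expand′ p) ⟩
    zeros d ++ (zeros (e ℕ.* suc d) ++ expand (suc e ℕ.* suc d) p)       ≡⟨ zeros-++-zeros d (e ℕ.* suc d) _ ⟩
    zeros (d ℕ.+ e ℕ.* suc d) ++ expand (suc e ℕ.* suc d) p             ∎)

expand-1 : ∀ p → expand 1 p ≡ p
expand-1 []      = refl
expand-1 (a ∷ p) = cong (a ∷_) (expand-1 p)

0∷-*P : ∀ p r → (+ 0 ∷ p) *P r ≋ + 0 ∷ (p *P r)
0∷-*P p r = coeffwise λ k → begin
  coeff (scaleP (+ 0) r +P (+ 0 ∷ (p *P r))) k        ≡⟨ coeff-+P (scaleP (+ 0) r) _ k ⟩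
  coeff (scaleP (+ 0) r) k + coeff (+ 0 ∷ (p *P r)) k  ≡⟨ cong (_+ coeff (+ 0 ∷ (p *P r)) k) (coeff-scaleP (+ 0) r k) ⟩
  + 0 + coeff (+ 0 ∷ (p *P r)) k                       ≡⟨ +-identityˡ _ ⟩
  coeff (+ 0 ∷ (p *P r)) k                             ∎
  where open ≡-Reasoning

zeros-++-*P : ∀ j p r → (zeros j ++ p) *P r ≋ zeros j ++ (p *P r)
zeros-++-*P zero    p r = ≋-refl
zeros-++-*P (suc j) p r = ≋-trans (0∷-*P (zeros j ++ p) r) (∷-cong refl (zeros-++-*P j p r))

expand-*P : ∀ d p r → expand (suc d) p *P expand (suc d) r ≋ expand (suc d) (p *P r)
expand-*P d []      r = ≋-refl
expand-*P d (a ∷ p) r = begin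
  scaleP a (expand (suc d) r) +P (+ 0 ∷ ((zeros d ++ expand (suc d) p) *P expand (suc d) r))
    ≈⟨ +P-cong ≋-refl (∷-cong refl (≋-trans (zeros-++-*P d _ _) (zeros-++-cong d (expand-*P d p r)))) ⟩
  scaleP a (expand (suc d) r) +P expand (suc d) (+ 0 ∷ (p *P r))
    ≡⟨ cong (_+P expand (suc d) (+ 0 ∷ (p *P r))) (sym (expand-scaleP (suc d) a r)) ⟩
  expand (suc d) (scaleP a r) +P expand (suc d) (+ 0 ∷ (p *P r))
    ≡⟨ sym (expand-+P (suc d) (scaleP a r) (+ 0 ∷ (p *P r))) ⟩
  expand (suc d) ((a ∷ p) *P r)
    ∎
  where open ≋-Reasoning

divSumStep : ℕ → (ℕ → ℕ → Poly) → ℕ → Poly → Poly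
divSumStep n f a acc = if ⌊ suc a ∣? n ⌋ then f (suc a) (n / suc a) +P acc else acc

coeff-divSumStep : ∀ n f a acc k →
  coeff (divSumStep n f a acc) k ≡ [ suc a ∣? n ]· coeff (f (suc a) (n / suc a)) k + coeff acc k
coeff-divSumStep n f a acc k with suc a ∣? n
... | yes _ = coeff-+P (f (suc a) (n / suc a)) acc k
... | no _  = sym (+-identityˡ (coeff acc k))

coeff-foldr-divSumStep : ∀ n f N acc k →
  coeff (foldr (divSumStep n f) acc (upTo N)) k ≡ (∑[ a < N ] [ suc a ∣? n ]· coeff (f (suc a) (n / suc a)) k) + coeff acc k
coeff-foldr-divSumStep n f zero    acc k = sym (+-identityˡ (coeff acc k))
coeff-foldr-divSumStep n f (suc N) acc k = begin
  coeff (foldr (divSumStep n f) acc (upTo (suc N))) k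
    ≡⟨ cong (λ as → coeff (foldr (divSumStep n f) acc as) k) (sym (upTo-∷ʳ N)) ⟩
  coeff (foldr (divSumStep n f) acc (upTo N ++ [ N ])) k
    ≡⟨ cong (λ q → coeff q k) (foldr-++ (divSumStep n f) acc (upTo N) [ N ]) ⟩
  coeff (foldr (divSumStep n f) (divSumStep n f N acc) (upTo N)) k
    ≡⟨ coeff-foldr-divSumStep n f N (divSumStep n f N acc) k ⟩
  S + coeff (divSumStep n f N acc) k
    ≡⟨ cong (_+_ S) (coeff-divSumStep n f N acc k) ⟩
  S + ([ suc N ∣? n ]· coeff (f (suc N) (n / suc N)) k + coeff acc k)
    ≡⟨ sym (+-assoc S _ (coeff acc k)) ⟩
  (S + [ suc N ∣? n ]· coeff (f (suc N) (n / suc N)) k) + coeff acc k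
    ∎
  where
  open ≡-Reasoning
  S : ℤ
  S = ∑[ a < N ] [ suc a ∣? n ]· coeff (f (suc a) (n / suc a)) k

opaque
  unfolding ∑∣

  coeff-divSum : ∀ n f k → coeff (divSum n f) k ≡ ∑[ d * m ≡ n ] coeff (f d m) k
  coeff-divSum n f k = trans (coeff-foldr-divSumStep n f n [] k) (+-identityʳ _)

expand-divSum : ∀ d n f → expand d (divSum n f) ≡ divSum n (λ e m → expand d (f e m))
expand-divSum d n f = go (upTo n)
  where
  go : ∀ as → expand d (foldr (divSumStep n f) [] as) ≡ foldr (divSumStep n (λ e m → expand d (f e m))) [] as
  go []       = refl
  go (a ∷ as) with suc a ∣? n
  ... | yes _ = trans (expand-+P d (f (suc a) (n / suc a)) _) (cong (expand d (f (suc a) (n / suc a)) +P_) (go as))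
  ... | no _  = go as

coeff-expand-divSum : ∀ d n f k → coeff (expand d (divSum n f)) k ≡ ∑[ e * m ≡ n ] coeff (expand d (f e m)) k
coeff-expand-divSum d n f k = trans (cong (λ p → coeff p k) (expand-divSum d n f)) (coeff-divSum n (λ e m → expand d (f e m)) k)

divSum-cong : ∀ n (f g : ℕ → ℕ → Poly) → (∀ d m → suc d ℕ.* m ≡ n → f (suc d) m ≋ g (suc d) m) → divSum n f ≋ divSum n g
divSum-cong n f g f≋g = coeffwise λ k → begin
  coeff (divSum n f) k                ≡⟨ coeff-divSum n f k ⟩
  ∑[ d * m ≡ n ] coeff (f d m) k      ≡⟨ ∑∣-cong n (λ d m dm≡n → coeff-≡ (f≋g d m dm≡n) k) ⟩
  ∑[ d * m ≡ n ] coeff (g d m) k      ≡⟨ coeff-divSum n g k ⟨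
  coeff (divSum n g) k                ∎
  where open ≡-Reasoning

möbiusTransform : (ℕ → Poly) → ℕ → Poly
möbiusTransform a n = divSum n (λ d m → scaleP (μ d) (expand d (a m)))

divisorTransform : (ℕ → Poly) → ℕ → Poly
divisorTransform h n = divSum n (λ d m → expand d (h m))

cofactor≥1 : ∀ {d m n} → d ℕ.* m ≡ n → 1 ≤ n → 1 ≤ m
cofactor≥1 {d} {m} refl n≥1 = >-nonZero⁻¹ m {{m*n≢0⇒n≢0 d {{>-nonZero n≥1}}}}

möbiusTransform-cong : ∀ {a b} → (∀ m → 1 ≤ m → a m ≋ b m) → ∀ {n} → 1 ≤ n → möbiusTransform a n ≋ möbiusTransform b n
möbiusTransform-cong {a} {b} a≋b {n} n≥1 =
  divSum-cong n (λ d m → scaleP (μ d) (expand d (a m))) (λ d m → scaleP (μ d) (expand d (b m)))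
    (λ d m dm≡n → scaleP-cong (μ (suc d)) (expand-cong (suc d) (a≋b m (cofactor≥1 {suc d} dm≡n n≥1))))

divisorTransform-cong : ∀ {h h′} → (∀ m → 1 ≤ m → h m ≋ h′ m) → ∀ {n} → 1 ≤ n → divisorTransform h n ≋ divisorTransform h′ n
divisorTransform-cong {h} {h′} h≋h′ {n} n≥1 =
  divSum-cong n (λ d m → expand d (h m)) (λ d m → expand d (h′ m)) (λ d m dm≡n → expand-cong (suc d) (h≋h′ m (cofactor≥1 {suc d} dm≡n n≥1)))

divSum-expand-*P : ∀ n (f g : ℕ → Poly) →
  divSum n (λ d m → expand d (f m) *P expand d (g m)) ≋ divisorTransform (λ m → f m *P g m) n
divSum-expand-*P n f g =
  divSum-cong n (λ d m → expand d (f m) *P expand d (g m)) (λ d m → expand d (f m *P g m)) (λ d m _ → expand-*P d (f m) (g m))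

möbiusTransform-divisorTransform : ∀ h {n} → 1 ≤ n → möbiusTransform (divisorTransform h) n ≋ h n
möbiusTransform-divisorTransform h {n} n≥1 = coeffwise λ j → let Y = λ c k → coeff (expand c (h k)) j in begin
  coeff (möbiusTransform (divisorTransform h) n) j
    ≡⟨ coeff-divSum n (λ d m → scaleP (μ d) (expand d (divisorTransform h m))) j ⟩
  ∑[ d * m ≡ n ] coeff (scaleP (μ d) (expand d (divisorTransform h m))) j
    ≡⟨ ∑∣-cong n (λ d m _ → trans (coeff-scaleP (μ (suc d)) (expand (suc d) (divisorTransform h m)) j)
                                   (cong (μ (suc d) *_) (coeff-expand-divSum (suc d) m (λ e k → expand e (h k)) j))) ⟩
  ∑[ d * m ≡ n ] μ d * (∑[ e * k ≡ m ] coeff (expand d (expand e (h k))) j)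
    ≡⟨ ∑∣-cong n (λ d m _ → trans (∑∣-*ˡ m (μ (suc d)) (λ e k → coeff (expand (suc d) (expand e (h k))) j))
                                   (∑∣-cong m (λ e k _ → cong (λ p → μ (suc d) * coeff p j) (expand-expand d e (h k))))) ⟩
  ∑[ d * m ≡ n ] ∑[ e * k ≡ m ] μ d * Y (d ℕ.* e) k
    ≡⟨ möbius-inversionˡ n≥1 Y ⟩
  coeff (expand 1 (h n)) j
    ≡⟨ cong (λ p → coeff p j) (expand-1 (h n)) ⟩
  coeff (h n) j
    ∎
  where open ≡-Reasoning

divisorTransform-möbiusTransform : ∀ a {n} → 1 ≤ n → divisorTransform (möbiusTransform a) n ≋ a n
divisorTransform-möbiusTransform a {n} n≥1 = coeffwise λ j → let Y = λ c k → coeff (expand c (a k)) j in begin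
  coeff (divisorTransform (möbiusTransform a) n) j
    ≡⟨ coeff-divSum n (λ d m → expand d (möbiusTransform a m)) j ⟩
  ∑[ d * m ≡ n ] coeff (expand d (möbiusTransform a m)) j
    ≡⟨ ∑∣-cong n (λ d m _ → coeff-expand-divSum (suc d) m (λ e k → scaleP (μ e) (expand e (a k))) j) ⟩
  ∑[ d * m ≡ n ] ∑[ e * k ≡ m ] coeff (expand d (scaleP (μ e) (expand e (a k)))) j
    ≡⟨ ∑∣-cong n (λ d m _ → ∑∣-cong m (λ e k _ → term d e k j)) ⟩
  ∑[ d * m ≡ n ] ∑[ e * k ≡ m ] μ e * Y (d ℕ.* e) k
    ≡⟨ möbius-inversionʳ n≥1 Y ⟩
  coeff (expand 1 (a n)) j
    ≡⟨ cong (λ p → coeff p j) (expand-1 (a n)) ⟩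
  coeff (a n) j
    ∎
  where
  open ≡-Reasoning
  term : ∀ d e k j → coeff (expand (suc d) (scaleP (μ (suc e)) (expand (suc e) (a k)))) j
                   ≡ μ (suc e) * coeff (expand (suc d ℕ.* suc e) (a k)) j
  term d e k j = begin
    coeff (expand (suc d) (scaleP (μ (suc e)) (expand (suc e) (a k)))) j
      ≡⟨ cong (λ p → coeff p j) (expand-scaleP (suc d) (μ (suc e)) (expand (suc e) (a k))) ⟩
    coeff (scaleP (μ (suc e)) (expand (suc d) (expand (suc e) (a k)))) j
      ≡⟨ coeff-scaleP (μ (suc e)) (expand (suc d) (expand (suc e) (a k))) j ⟩
    μ (suc e) * coeff (expand (suc d) (expand (suc e) (a k))) j
      ≡⟨ cong (λ p → μ (suc e) * coeff p j) (expand-expand d e (a k)) ⟩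
    μ (suc e) * coeff (expand (suc d ℕ.* suc e) (a k)) j
      ∎

mainTheorem19 : (a : ℕ → Poly) →
    (IsQGauss a → Σ (ℕ → Poly) λ g → ∀ n → 1 ≤ n →
        a n ≈P divSum n (λ d m → expand d (qint m) *P expand d (g m)))
    × ((Σ (ℕ → Poly) λ g → ∀ n → 1 ≤ n →
        a n ≈P divSum n (λ d m → expand d (qint m) *P expand d (g m))) → IsQGauss a)
mainTheorem19 a = gauss⇒expansion , expansion⇒gauss
  where
  open ≋-Reasoning
  gauss⇒expansion : IsQGauss a → Σ (ℕ → Poly) λ g → ∀ n → 1 ≤ n →
                      a n ≈P divSum n (λ d m → expand d (qint m) *P expand d (g m))
  gauss⇒expansion gauss = g , λ n n≥1 → coeff-≡ (begin
    a n                                                      ≈⟨ divisorTransform-möbiusTransform a n≥1 ⟨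
    divisorTransform (möbiusTransform a) n                   ≈⟨ divisorTransform-cong quotient n≥1 ⟩
    divisorTransform (λ m → qint m *P g m) n                 ≈⟨ divSum-expand-*P n qint g ⟨
    divSum n (λ d m → expand d (qint m) *P expand d (g m))   ∎)
    where
    g : ℕ → Poly
    g zero    = []
    g (suc m) = proj₁ (gauss (suc m) (s≤s z≤n))
    quotient : ∀ m → 1 ≤ m → möbiusTransform a m ≋ qint m *P g m
    quotient (suc m) _ = coeffwise (proj₂ (gauss (suc m) (s≤s z≤n)))
  expansion⇒gauss : (Σ (ℕ → Poly) λ g → ∀ n → 1 ≤ n →
                      a n ≈P divSum n (λ d m → expand d (qint m) *P expand d (g m))) → IsQGauss a
  expansion⇒gauss (g , expansion) n n≥1 = g n , coeff-≡ (begin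
    möbiusTransform a n                                       ≈⟨ möbiusTransform-cong a≋ n≥1 ⟩
    möbiusTransform (divisorTransform (λ m → qint m *P g m)) n ≈⟨ möbiusTransform-divisorTransform (λ m → qint m *P g m) n≥1 ⟩
    qint n *P g n                                             ∎)
    where
    a≋ : ∀ m → 1 ≤ m → a m ≋ divisorTransform (λ m → qint m *P g m) m
    a≋ m m≥1 = ≋-trans (coeffwise (expansion m m≥1)) (divSum-expand-*P m qint g)
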